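{- Let $\nu$ be a lattice path and let $T$ be a $\nu$-tree. Then $T$ contains: (1) the top-left corner of $A_\nu$ (called the root of $T$); (2) every valley of $\nu$, i.e. every lattice point of $\nu$ preceded by an east step and followed by a north step; (3) the starting point of each north step in the initial run of north steps of $\nu$; (4) the ending point of each east step in the final run of east steps of $\nu$; (5) at least one point in each column of $A_\nu$; (6) at least one point in each row of $A_\nu$; (7) for every point $p\in T$ other than the root, either there is a point of $T$ strictly above $p$ in the same column, or there is a point of $T$ strictly to the left of $p$ in the same row, but not both.
   Context: A lattice path $\nu$ is a finite sequence of unit north steps $\mathsf{N}$ and east steps $\mathsf{E}$ in $\mathbb{Z}^2$. Let $F_\nu$ be the Ferrers diagram (region) lying weakly above $\nu$ inside the smallest axis-parallel rectangle containing $\nu$, and let $A_\nu$ be the set of lattice points of $F_\nu$ (the lattice points weakly above $\nu$ in that rectangle). Two points $p,q\in A_\nu$ are $\nu$-incompatible if one of them lies strictly southwest of the other (strictly smaller in both coordinates) and the smallest axis-parallel rectangle containing $p$ and $q$ lies entirely inside $F_\nu$; otherwise they are $\nu$-compatible. A $\nu$-tree is an inclusion-maximal subset of $A_\nu$ consisting of pairwise $\nu$-compatible points. -}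

module Defs where

open import Data.Nat using (ℕ; zero; suc; _≤_; _<_)
open import Data.Product using (_×_; _,_; proj₁; proj₂; ∃; ∃-syntax)
open import Data.Sum using (_⊎_)
open import Data.List using (List; []; _∷_; _++_)
open import Data.List.Membership.Propositional using (_∈_)
open import Relation.Binary.PropositionalEquality using (_≡_)
open import Relation.Nullary using (¬_)

data Step : Set where
  N E : Step

-- A lattice path is a finite sequence of steps.  By translation we place it
-- starting at the origin (0,0); coordinates are (x , y) with x to the east
-- and y to the north.
Path : Set
Path = List Step

Point : Set
Point = ℕ × ℕ

#E : Path → ℕ
#E []       = zero
#E (E ∷ ν)  = suc (#E ν)
#E (N ∷ ν)  = #E ν

#N : Path → ℕ
#N []       = zero
#N (N ∷ ν)  = suc (#N ν)
#N (E ∷ ν)  = #N ν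

endpt : Path → Point
endpt u = #E u , #N u

OnPath : Path → Point → Set
OnPath ν p = ∃[ u ] ∃[ w ] (ν ≡ u ++ w × endpt u ≡ p)

-- A_ν : lattice points of the smallest rectangle [0,#E ν]×[0,#N ν]
-- containing ν that lie weakly above ν (some lattice point of ν lies weakly
-- below them in the same column).
InA : Path → Point → Set
InA ν (x , y) =
  x ≤ #E ν × y ≤ #N ν × ∃[ y' ] (OnPath ν (x , y') × y' ≤ y)

SW : Point → Point → Set
SW (x₁ , y₁) (x₂ , y₂) = x₁ < x₂ × y₁ < y₂

-- the (closed) rectangle with lower-left corner p and upper-right corner q
-- lies inside F_ν; since F_ν is a union of closed unit cells of the lattice
-- and this rectangle has lattice corners, this is equivalent to all its
-- lattice points lying in A_ν.
BoxInside : Path → Point → Point → Set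
BoxInside ν (x₁ , y₁) (x₂ , y₂) =
  ∀ x y → x₁ ≤ x → x ≤ x₂ → y₁ ≤ y → y ≤ y₂ → InA ν (x , y)

Incompatible : Path → Point → Point → Set
Incompatible ν p q = (SW p q × BoxInside ν p q) ⊎ (SW q p × BoxInside ν q p)

Compatible : Path → Point → Point → Set
Compatible ν p q = ¬ Incompatible ν p q

_⊆_ : List Point → List Point → Set
S ⊆ T = ∀ {p} → p ∈ S → p ∈ T

SubsetA : Path → List Point → Set
SubsetA ν S = ∀ {p} → p ∈ S → InA ν p

PairwiseCompatible : Path → List Point → Set
PairwiseCompatible ν S = ∀ {p q} → p ∈ S → q ∈ S → Compatible ν p q

IsTree : Path → List Point → Set
IsTree ν T =
  SubsetA ν T × PairwiseCompatible ν T ×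
  (∀ S → T ⊆ S → SubsetA ν S → PairwiseCompatible ν S → S ⊆ T)

root : Path → Point
root ν = 0 , #N ν

ContainsValleys : Path → List Point → Set
ContainsValleys ν T =
  ∀ u w → ν ≡ u ++ (E ∷ N ∷ w) → endpt (u ++ (E ∷ [])) ∈ T

ContainsInitialNorth : Path → List Point → Set
ContainsInitialNorth ν T =
  ∀ u w → ν ≡ u ++ (N ∷ w) → (∀ {s} → s ∈ u → s ≡ N) → endpt u ∈ T

ContainsFinalEast : Path → List Point → Set
ContainsFinalEast ν T =
  ∀ u w → ν ≡ u ++ (E ∷ w) → (∀ {s} → s ∈ w → s ≡ E) →
  endpt (u ++ (E ∷ [])) ∈ T

MeetsColumns : Path → List Point → Set
MeetsColumns ν T = ∀ x → x ≤ #E ν → ∃[ y ] ((x , y) ∈ T)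

MeetsRows : Path → List Point → Set
MeetsRows ν T = ∀ y → y ≤ #N ν → ∃[ x ] ((x , y) ∈ T)

AboveInT : List Point → Point → Set
AboveInT T (x , y) = ∃[ y' ] (y < y' × (x , y') ∈ T)

LeftInT : List Point → Point → Set
LeftInT T (x , y) = ∃[ x' ] (x' < x × (x' , y) ∈ T)

ExactlyOneParentDir : Path → List Point → Set
ExactlyOneParentDir ν T =
  ∀ p → p ∈ T → ¬ (p ≡ root ν) →
  (AboveInT T p ⊎ LeftInT T p) × ¬ (AboveInT T p × LeftInT T p)

-- Everything follows from maximality: a point of A_ν compatible with all of T lies in T.
-- Since F_ν is closed under moving up and to the left, a box lies in F_ν exactly when its
-- lower-right corner lies in A_ν.  So a point of ν entered by an east step has nothing of
-- A_ν below it in its column, and nothing is incompatible with it from the southwest; a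
-- point of ν left by a north step has nothing of A_ν to its right in its row, and nothing
-- is incompatible with it from the northeast.  With the boundary of the rectangle this
-- gives (1)-(4).  If T missed a column, the lowest point of T to its left whose row meets
-- the column inside A_ν could be moved right onto the column, and without such a point the
-- top of the column could be added; rows are symmetric, using the rightmost point of T
-- above the row.  (7) is the same argument, and a point with parents in both directions
-- would make those two parents incompatible.
module Submission where

open import Defs
open import Data.Product using (_×_)
open import Data.List using (List)
open import Data.List.Membership.Propositional using (_∈_)

open import Data.Empty using (⊥; ⊥-elim)
open import Data.List using ([]; _∷_; _++_)
open import Data.List.Membership.Propositional using (_∉_; find; lose)
open import Data.List.Properties using (++-assoc; ++-identityʳ; ∷-injective)
open import Data.List.Relation.Unary.Any using (Any; here; there; any?)
open import Data.Nat using (ℕ; suc; _+_; _∸_; _≤_; _<_; z≤n; s≤s⁻¹; _≟_; _<?_)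
open import Data.Nat.Induction using (<-wellFounded)
open import Data.Nat.Properties
open import Data.Product using (_,_; proj₁; proj₂; ∃-syntax)
open import Data.Sum using (_⊎_; inj₁; inj₂)
open import Function using (_∘_)
open import Induction.WellFounded using (module All)
open import Level using (0ℓ)
import Relation.Binary.Construct.On as On
open import Relation.Binary.Definitions using (tri<; tri≈; tri>)
open import Relation.Binary.PropositionalEquality
open import Relation.Nullary using (¬_; yes; no)
open import Relation.Nullary.Decidable using (decidable-stable; _×-dec_; _⊎-dec_)
open import Relation.Unary using (Decidable)

noMinimalCounterexample : ∀ {A : Set} (f : A → ℕ) (P : A → Set) →
  (∀ {a} → P a → (∀ {b} → P b → f b < f a → ⊥) → ⊥) → ∀ {a} → ¬ P a
noMinimalCounterexample f P minimal {a} =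
  All.wfRec (On.wellFounded f <-wellFounded) 0ℓ (¬_ ∘ P)
    (λ _ smaller Pa → minimal Pa (λ Pb fb<fa → smaller fb<fa Pb)) a

∃∈-stable : ∀ {A : Set} {P : A → Set} {xs : List A} → Decidable P →
  ¬ ¬ Any P xs → ∃[ x ] (x ∈ xs × P x)
∃∈-stable {xs = xs} P? = find ∘ decidable-stable (any? P? xs)

#E-++ : ∀ u v → #E (u ++ v) ≡ #E u + #E v
#E-++ []      v = refl
#E-++ (N ∷ u) v = #E-++ u v
#E-++ (E ∷ u) v = cong suc (#E-++ u v)

#N-++ : ∀ u v → #N (u ++ v) ≡ #N u + #N v
#N-++ []      v = refl
#N-++ (E ∷ u) v = #N-++ u v
#N-++ (N ∷ u) v = cong suc (#N-++ u v)

#E-++-≤ : ∀ u v → #E u ≤ #E (u ++ v)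
#E-++-≤ u v = subst (#E u ≤_) (sym (#E-++ u v)) (m≤m+n _ _)

#N-++-≤ : ∀ u v → #N u ≤ #N (u ++ v)
#N-++-≤ u v = subst (#N u ≤_) (sym (#N-++ u v)) (m≤m+n _ _)

#E-∷ʳE : ∀ u → #E (u ++ E ∷ []) ≡ suc (#E u)
#E-∷ʳE u = trans (#E-++ u _) (+-comm _ 1)

#N-∷ʳE : ∀ u → #N (u ++ E ∷ []) ≡ #N u
#N-∷ʳE u = trans (#N-++ u _) (+-identityʳ _)

#E-∷ʳN : ∀ u → #E (u ++ N ∷ []) ≡ #E u
#E-∷ʳN u = trans (#E-++ u _) (+-identityʳ _)

#N-∷ʳN : ∀ u → #N (u ++ N ∷ []) ≡ suc (#N u)
#N-∷ʳN u = trans (#N-++ u _) (+-comm _ 1)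

#E-allN : ∀ u → (∀ {s} → s ∈ u → s ≡ N) → #E u ≡ 0
#E-allN []      allN = refl
#E-allN (N ∷ u) allN = #E-allN u (allN ∘ there)
#E-allN (E ∷ u) allN with () ← allN (here refl)

#N-allE : ∀ u → (∀ {s} → s ∈ u → s ≡ E) → #N u ≡ 0
#N-allE []      allE = refl
#N-allE (E ∷ u) allE = #N-allE u (allE ∘ there)
#N-allE (N ∷ u) allE with () ← allE (here refl)

++-prefix-total : ∀ (u w u′ w′ : Path) → u ++ w ≡ u′ ++ w′ →
  (∃[ v ] u′ ≡ u ++ v) ⊎ (∃[ v ] u ≡ u′ ++ v)
++-prefix-total []      w u′       w′ eq = inj₁ (u′ , refl)
++-prefix-total (s ∷ u) w []       w′ eq = inj₂ (s ∷ u , refl)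
++-prefix-total (s ∷ u) w (_ ∷ u′) w′ eq with refl , eq′ ← ∷-injective eq
  with ++-prefix-total u w u′ w′ eq′
... | inj₁ (v , u′≡) = inj₁ (v , cong (s ∷_) u′≡)
... | inj₂ (v , u≡)  = inj₂ (v , cong (s ∷_) u≡)

prefix-#E<⇒#N≤ : ∀ (u w u′ w′ : Path) → u ++ w ≡ u′ ++ w′ → #E u < #E u′ → #N u ≤ #N u′
prefix-#E<⇒#N≤ u w u′ w′ eq lt with ++-prefix-total u w u′ w′ eq
... | inj₁ (v , refl) = #N-++-≤ u v
... | inj₂ (v , refl) = ⊥-elim (<⇒≱ lt (#E-++-≤ u′ v))

prefix-with-#E : ∀ u {x} → x ≤ #E u → ∃[ u₁ ] ∃[ u₂ ] (u ≡ u₁ ++ u₂ × #E u₁ ≡ x)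
prefix-with-#E u       {0}     _ = [] , u , refl , refl
prefix-with-#E (N ∷ u) {suc x} x≤
  with u₁ , u₂ , refl , #E≡ ← prefix-with-#E u x≤ = N ∷ u₁ , u₂ , refl , #E≡
prefix-with-#E (E ∷ u) {suc x} x≤
  with u₁ , u₂ , refl , #E≡ ← prefix-with-#E u (s≤s⁻¹ x≤) = E ∷ u₁ , u₂ , refl , cong suc #E≡

OnPath-left : ∀ {ν x y x′} → OnPath ν (x , y) → x′ ≤ x →
  ∃[ y′ ] (OnPath ν (x′ , y′) × y′ ≤ y)
OnPath-left (u , w , refl , refl) x′≤
  with u₁ , u₂ , refl , refl ← prefix-with-#E u x′≤ =
  #N u₁ , (u₁ , u₂ ++ w , ++-assoc u₁ u₂ w , refl) , #N-++-≤ u₁ u₂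

OnPath⇒InA : ∀ {ν p} → OnPath ν p → InA ν p
OnPath⇒InA on@(u , w , refl , refl) = #E-++-≤ u w , #N-++-≤ u w , _ , on , ≤-refl

InA-up : ∀ {ν x y y′} → InA ν (x , y) → y ≤ y′ → y′ ≤ #N ν → InA ν (x , y′)
InA-up (x≤ , _ , y₀ , on , y₀≤) y≤y′ y′≤ = x≤ , y′≤ , y₀ , on , ≤-trans y₀≤ y≤y′

InA-left : ∀ {ν x y x′} → InA ν (x , y) → x′ ≤ x → InA ν (x′ , y)
InA-left (x≤ , y≤ , _ , on , y₀≤) x′≤x with y₁ , on′ , y₁≤ ← OnPath-left on x′≤x =
  ≤-trans x′≤x x≤ , y≤ , y₁ , on′ , ≤-trans y₁≤ y₀≤

InA-top : ∀ {ν x} → x ≤ #E ν → InA ν (x , #N ν)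
InA-top {ν} x≤ = InA-left (OnPath⇒InA (ν , [] , sym (++-identityʳ ν) , refl)) x≤

InA-leftColumn : ∀ {ν y} → y ≤ #N ν → InA ν (0 , y)
InA-leftColumn {ν} y≤ = z≤n , y≤ , 0 , ([] , ν , refl , refl) , z≤n

InA-abovePrefix : ∀ {ν x y} u w → ν ≡ u ++ w → #E u < x → InA ν (x , y) → #N u ≤ y
InA-abovePrefix u w ν≡ lt (_ , _ , _ , (u′ , w′ , ν≡′ , refl) , y′≤) =
  ≤-trans (prefix-#E<⇒#N≤ u w u′ w′ (trans (sym ν≡) ν≡′) lt) y′≤

SWIncompatible : Path → Point → Point → Set
SWIncompatible ν p q = SW p q × BoxInside ν p q

lowerRight : Point → Point → Point
lowerRight (_ , y₁) (x₂ , _) = x₂ , y₁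

SWIncompatible⇒InA : ∀ {ν} p q → SWIncompatible ν p q → InA ν (lowerRight p q)
SWIncompatible⇒InA (x₁ , y₁) (x₂ , y₂) ((x₁< , y₁<) , box) =
  box x₂ y₁ (<⇒≤ x₁<) ≤-refl ≤-refl (<⇒≤ y₁<)

InA⇒SWIncompatible : ∀ {ν} p q → SW p q → InA ν (lowerRight p q) → proj₂ q ≤ #N ν →
  SWIncompatible ν p q
InA⇒SWIncompatible (x₁ , y₁) (x₂ , y₂) sw corner y₂≤ =
  sw , λ x y _ x≤ y₁≤ y≤ → InA-left (InA-up corner y₁≤ (≤-trans y≤ y₂≤)) x≤

noneSWOfLeftColumn : ∀ {ν t y} → ¬ SWIncompatible ν t (0 , y)
noneSWOfLeftColumn ((() , _) , _)

noneSWAfterEast : ∀ {ν t} u w → ν ≡ u ++ E ∷ w →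
  ¬ SWIncompatible ν t (endpt (u ++ E ∷ []))
noneSWAfterEast {t = a , b} u w ν≡ inc@((_ , b<) , _) =
  <⇒≱ b< (subst (_≤ b) (sym (#N-∷ʳE u))
    (InA-abovePrefix u (E ∷ w) ν≡ (≤-reflexive (sym (#E-∷ʳE u))) corner))
  where
  corner : InA _ (#E (u ++ E ∷ []) , b)
  corner = SWIncompatible⇒InA (a , b) (endpt (u ++ E ∷ [])) inc

noneNEBeforeNorth : ∀ {ν t} u w → ν ≡ u ++ N ∷ w → ¬ SWIncompatible ν (endpt u) t
noneNEBeforeNorth {t = a , b} u w ν≡ inc@((a> , _) , _) =
  1+n≰n (subst (_≤ #N u) (#N-∷ʳN u)
    (InA-abovePrefix (u ++ N ∷ []) w (trans ν≡ (sym (++-assoc u (N ∷ []) w)))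
      (subst (_< a) (sym (#E-∷ʳN u)) a>) (SWIncompatible⇒InA (endpt u) (a , b) inc)))

module _ {ν : Path} {T : List Point} (tree : IsTree ν T) where

  private
    T⊆A : SubsetA ν T
    T⊆A = proj₁ tree

    ∈T⇒≤#N : ∀ {x y} → (x , y) ∈ T → y ≤ #N ν
    ∈T⇒≤#N = proj₁ ∘ proj₂ ∘ T⊆A

  noSWIncompatible : ∀ {p q} → p ∈ T → q ∈ T → ¬ SWIncompatible ν p q
  noSWIncompatible p∈ q∈ inc = proj₁ (proj₂ tree) p∈ q∈ (inj₁ inc)

  compatible⇒∈T : ∀ {c} → InA ν c →
    (∀ {t} → t ∈ T → ¬ SWIncompatible ν c t) →
    (∀ {t} → t ∈ T → ¬ SWIncompatible ν t c) → c ∈ T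
  compatible⇒∈T {c} c∈A noneNE noneSW =
    proj₂ (proj₂ tree) (c ∷ T) there extended pairwise (here refl)
    where
    compatible : ∀ {t} → t ∈ T → Compatible ν c t
    compatible t∈ (inj₁ inc) = noneNE t∈ inc
    compatible t∈ (inj₂ inc) = noneSW t∈ inc

    extended : SubsetA ν (c ∷ T)
    extended (here refl) = c∈A
    extended (there t∈) = T⊆A t∈

    pairwise : PairwiseCompatible ν (c ∷ T)
    pairwise (here refl) (here refl) (inj₁ ((c< , _) , _)) = <-irrefl refl c<
    pairwise (here refl) (here refl) (inj₂ ((c< , _) , _)) = <-irrefl refl c<
    pairwise (here refl) (there t∈) = compatible t∈
    pairwise (there t∈) (here refl) (inj₁ inc) = compatible t∈ (inj₂ inc)
    pairwise (there t∈) (here refl) (inj₂ inc) = compatible t∈ (inj₁ inc)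
    pairwise (there t∈) (there t′∈) = proj₁ (proj₂ tree) t∈ t′∈

  noneNEOfTopRow : ∀ {x t} → t ∈ T → ¬ SWIncompatible ν (x , #N ν) t
  noneNEOfTopRow t∈ ((_ , N<) , _) = <⇒≱ N< (∈T⇒≤#N t∈)

  root∈T : root ν ∈ T
  root∈T = compatible⇒∈T (InA-top z≤n) noneNEOfTopRow (λ _ → noneSWOfLeftColumn)

  valleys∈T : ContainsValleys ν T
  valleys∈T u w ν≡ = compatible⇒∈T
    (OnPath⇒InA (u ++ E ∷ [] , N ∷ w , ν≡′ , refl))
    (λ _ → noneNEBeforeNorth (u ++ E ∷ []) w ν≡′)
    (λ _ → noneSWAfterEast u (N ∷ w) ν≡)
    where
    ν≡′ : ν ≡ (u ++ E ∷ []) ++ N ∷ w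
    ν≡′ = trans ν≡ (sym (++-assoc u (E ∷ []) (N ∷ w)))

  initialNorth∈T : ContainsInitialNorth ν T
  initialNorth∈T u w ν≡ allN = compatible⇒∈T
    (OnPath⇒InA (u , N ∷ w , ν≡ , refl))
    (λ _ → noneNEBeforeNorth u w ν≡)
    (λ _ → subst (λ x → ¬ SWIncompatible ν _ (x , #N u)) (sym (#E-allN u allN)) noneSWOfLeftColumn)

  finalEast∈T : ContainsFinalEast ν T
  finalEast∈T u w ν≡ allE = compatible⇒∈T
    (OnPath⇒InA (u ++ E ∷ [] , w , trans ν≡ (sym (++-assoc u (E ∷ []) w)) , refl))
    (λ t∈ → subst (λ y → ¬ SWIncompatible ν (#E (u ++ E ∷ []) , y) _) (sym onTopRow)
      (noneNEOfTopRow t∈))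
    (λ _ → noneSWAfterEast u w ν≡)
    where
    onTopRow : #N (u ++ E ∷ []) ≡ #N ν
    onTopRow = begin
      #N (u ++ E ∷ [])     ≡⟨ #N-∷ʳE u ⟩
      #N u                 ≡⟨ +-identityʳ (#N u) ⟨
      #N u + 0             ≡⟨ cong (#N u +_) (#N-allE w allE) ⟨
      #N u + #N (E ∷ w)    ≡⟨ #N-++ u (E ∷ w) ⟨
      #N (u ++ E ∷ w)      ≡⟨ cong #N ν≡ ⟨
      #N ν                 ∎
      where open ≡-Reasoning

  columnLemma : ∀ {x L} → x ≤ #E ν → L ≤ #N ν →
    (∀ {y} → L ≤ y → (x , y) ∉ T) →
    (∀ {a b} → (a , b) ∈ T → a < x → InA ν (x , b) → L ≤ b) → ⊥
  columnLemma {x} x≤ L≤ noneHigh leftHigh =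
    noneHigh L≤ (compatible⇒∈T (InA-top x≤) noneNEOfTopRow (λ t∈ → noWitness ∘ witness t∈))
    where
    Witness : Point → Set
    Witness (a , b) = (a , b) ∈ T × a < x × InA ν (x , b)

    witness : ∀ {t y} → t ∈ T → SWIncompatible ν t (x , y) → Witness t
    witness {t} t∈ inc@((a< , _) , _) = t∈ , a< , SWIncompatible⇒InA t (x , _) inc

    projectRight : ∀ {r} → Witness r → (∀ {t} → Witness t → proj₂ t < proj₂ r → ⊥) → ⊥
    projectRight {a , b} (r∈ , a<x , xb∈A) lower =
      noneHigh (leftHigh r∈ a<x xb∈A)
        (compatible⇒∈T xb∈A noneNE (λ t∈ inc → lower (witness t∈ inc) (proj₂ (proj₁ inc))))
      where
      noneNE : ∀ {t} → t ∈ T → ¬ SWIncompatible ν (x , b) t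
      noneNE {a′ , b′} t∈ inc@((x<a′ , b<b′) , _) =
        noSWIncompatible r∈ t∈ (InA⇒SWIncompatible (a , b) (a′ , b′)
          (<-trans a<x x<a′ , b<b′) (SWIncompatible⇒InA (x , b) (a′ , b′) inc) (∈T⇒≤#N t∈))

    noWitness : ∀ {t} → ¬ Witness t
    noWitness = noMinimalCounterexample proj₂ Witness projectRight

  rowLemma : ∀ {y} → y ≤ #N ν → (∀ {x} → (x , y) ∉ T) → ⊥
  rowLemma {y} y≤ noneInRow =
    noneInRow (compatible⇒∈T (InA-leftColumn y≤) (λ t∈ → noWitness ∘ witness t∈)
      (λ _ → noneSWOfLeftColumn))
    where
    Witness : Point → Set
    Witness (a , b) = (a , b) ∈ T × y < b × InA ν (a , y)

    witness : ∀ {t x} → t ∈ T → SWIncompatible ν (x , y) t → Witness t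
    witness {t} t∈ inc@((_ , y<) , _) = t∈ , y< , SWIncompatible⇒InA (_ , y) t inc

    projectDown : ∀ {q} → Witness q → (∀ {t} → Witness t → #E ν ∸ proj₁ t < #E ν ∸ proj₁ q → ⊥) → ⊥
    projectDown {a , b} (q∈ , y<b , ay∈A) further =
      noneInRow (compatible⇒∈T ay∈A
        (λ t∈ inc → further (witness t∈ inc) (∸-monoʳ-< (proj₁ (proj₁ inc)) (proj₁ (T⊆A t∈))))
        noneSW)
      where
      noneSW : ∀ {t} → t ∈ T → ¬ SWIncompatible ν t (a , y)
      noneSW {a′ , b′} t∈ inc@((a′<a , b′<y) , _) =
        noSWIncompatible t∈ q∈ (InA⇒SWIncompatible (a′ , b′) (a , b)
          (a′<a , <-trans b′<y y<b) (SWIncompatible⇒InA (a′ , b′) (a , y) inc) (∈T⇒≤#N q∈))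

    noWitness : ∀ {t} → ¬ Witness t
    noWitness = noMinimalCounterexample ((#E ν ∸_) ∘ proj₁) Witness projectDown

  meetsColumns : MeetsColumns ν T
  meetsColumns x x≤
    with (_ , y) , p∈ , refl ← ∃∈-stable (λ q → proj₁ q ≟ x) (λ none →
      columnLemma x≤ z≤n (λ _ p∈ → none (lose p∈ refl)) (λ _ _ _ → z≤n))
    = y , p∈

  meetsRows : MeetsRows ν T
  meetsRows y y≤
    with (x , _) , p∈ , refl ← ∃∈-stable (λ q → proj₂ q ≟ y) (λ none →
      rowLemma y≤ (λ p∈ → none (lose p∈ refl)))
    = x , p∈

  exactlyOneParentDir : ExactlyOneParentDir ν T
  exactlyOneParentDir (x , y) p∈ p≢root = aboveOrLeft , notBoth
    where
    p∈A : InA ν (x , y)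
    p∈A = T⊆A p∈

    notBoth : ¬ (AboveInT T (x , y) × LeftInT T (x , y))
    notBoth ((y′ , y<y′ , above∈) , (x′ , x′<x , left∈)) = noSWIncompatible left∈ above∈
      (InA⇒SWIncompatible (x′ , y) (x , y′) (x′<x , y<y′) p∈A (∈T⇒≤#N above∈))

    Parent : Point → Set
    Parent (a , b) = (a ≡ x × y < b) ⊎ (a < x × b ≡ y)

    parent? : Decidable Parent
    parent? (a , b) = (a ≟ x ×-dec y <? b) ⊎-dec (a <? x ×-dec b ≟ y)

    noParent⇒⊥ : ¬ Any Parent T → ⊥
    noParent⇒⊥ none with m≤n⇒m<n∨m≡n (∈T⇒≤#N p∈)
    ... | inj₂ refl with x ≟ 0
    ...   | yes refl = p≢root refl
    ...   | no x≢0   = none (lose root∈T (inj₂ (n≢0⇒n>0 x≢0 , refl)))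
    noParent⇒⊥ none | inj₁ y<N = columnLemma (proj₁ p∈A) y<N
      (λ y< above∈ → none (lose above∈ (inj₁ (refl , y<))))
      leftHigh
      where
      leftHigh : ∀ {a b} → (a , b) ∈ T → a < x → InA ν (x , b) → suc y ≤ b
      leftHigh {a} {b} r∈ a<x xb∈A with <-cmp b y
      ... | tri< b<y _ _ = ⊥-elim (noSWIncompatible r∈ p∈
              (InA⇒SWIncompatible (a , b) (x , y) (a<x , b<y) xb∈A (∈T⇒≤#N p∈)))
      ... | tri≈ _ refl _ = ⊥-elim (none (lose r∈ (inj₂ (a<x , refl))))
      ... | tri> _ _ y<b = y<b

    aboveOrLeft : AboveInT T (x , y) ⊎ LeftInT T (x , y)
    aboveOrLeft with ∃∈-stable parent? noParent⇒⊥
    ... | (_ , b) , q∈ , inj₁ (refl , y<b) = inj₁ (b , y<b , q∈)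
    ... | (a , _) , q∈ , inj₂ (a<x , refl) = inj₂ (a , a<x , q∈)

lemma2p2 : (ν : Path) (T : List Point) → IsTree ν T →
    root ν ∈ T × ContainsValleys ν T × ContainsInitialNorth ν T ×
    ContainsFinalEast ν T × MeetsColumns ν T × MeetsRows ν T ×
    ExactlyOneParentDir ν T
lemma2p2 ν T tree =
  root∈T tree , valleys∈T tree , initialNorth∈T tree , finalEast∈T tree ,
  meetsColumns tree , meetsRows tree , exactlyOneParentDir tree
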